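{- $\mathsf{LTL}_{\mathsf{F},\land}[\{p,q,r\}]$ does not admit finite characterizations over $\mathcal{W}^{\leq\omega}$, nor over $\mathcal{W}^{=\omega}$.
   Context: Words: for a countable ordinal $\alpha$, an $\alpha$-word over $\mathsf{AP}=\{p,q,r\}$ is a function $w:\alpha\to\mathcal{P}(\mathsf{AP})$; $|w|=\alpha$; $w[\beta..]$ is the suffix $w'$ with $w'[\gamma]=w[\beta+\gamma]$. $\mathcal{W}^{\leq\omega}$: words of length $\leq\omega$; $\mathcal{W}^{=\omega}$: words of length exactly $\omega$. Semantics: $w\models s$ ($s\in\mathsf{AP}$) iff $s\in w[0]$; $\land$ as usual; $w\models\mathsf{F}\varphi$ iff there is $\alpha<|w|$ with $w[\alpha..]\models\varphi$. $\mathsf{LTL}_{\mathsf{F},\land}[\{p,q,r\}]$ is the set of formulas built from $p,q,r$ using only $\mathsf{F}$ and $\land$. $[\![\varphi]\!]$ denotes the set of all countable-ordinal-length words satisfying $\varphi$. A labeled example is $(w,\ell)$ with $\ell\in\{+,-\}$; $\varphi$ fits it if ($w\models\varphi$ and $\ell=+$) or ($w\not\models\varphi$ and $\ell=-$). A fragment $\mathcal{L}$ admits finite characterizations over a class $\mathcal{W}$ of words if for every $\varphi\in\mathcal{L}$ there is a finite set $E$ of labeled examples with words in $\mathcal{W}$ such that $\varphi$ fits $E$ and every $\psi\in\mathcal{L}$ fitting $E$ satisfies $[\![\psi]\!]\cap\mathcal{W}=[\![\varphi]\!]\cap\mathcal{W}$. -}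

module Defs where

open import Data.Nat using (ℕ; zero; suc; _≤_)
open import Data.Fin using (Fin; toℕ)
open import Data.Fin.Subset using (Subset; _∈_)
open import Data.Product using (Σ; _×_; ∃)
open import Data.List using (List)
open import Data.List.Relation.Unary.All using (All)
open import Data.Unit using (⊤)
open import Data.Empty using (⊥)
open import Relation.Nullary using (¬_)
open import Function.Bundles using (_⇔_)

-- Atomic propositions AP = {p, q, r}, encoded as Fin 3 (p = 0, q = 1, r = 2).
AP : Set
AP = Fin 3

Letter : Set
Letter = Subset 3

data Formula : Set where
  atom : AP → Formula
  F    : Formula → Formula
  _∧_  : Formula → Formula → Formula

-- Words of length ≤ ω (nonempty): finite words of length (suc n),
-- and ω-words.
data Word : Set where
  fin : (n : ℕ) → (Fin (suc n) → Letter) → Word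
  inf : (ℕ → Letter) → Word

Pos : Word → Set
Pos (fin n _) = Fin (suc n)
Pos (inf _)   = ℕ

pos0 : (w : Word) → Pos w
pos0 (fin n _) = Fin.zero
pos0 (inf _)   = zero

letter : (w : Word) → Pos w → Letter
letter (fin n f) i = f i
letter (inf f)   i = f i

_≤ₚ_ : {w : Word} → Pos w → Pos w → Set
_≤ₚ_ {fin n _} i j = toℕ i ≤ toℕ j
_≤ₚ_ {inf _}   i j = i ≤ j

-- w , i ⊨ φ  means  the suffix w[i..] satisfies φ.
-- (w[i..] ⊨ F φ iff some α < |w[i..]| has w[i+α..] ⊨ φ, i.e. some
--  position j ≥ i of w has w[j..] ⊨ φ.)
_,_⊨_ : (w : Word) → Pos w → Formula → Set
w , i ⊨ atom s  = s ∈ letter w i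
w , i ⊨ F φ     = Σ (Pos w) λ j → (_≤ₚ_ {w} i j) × (w , j ⊨ φ)
w , i ⊨ (φ ∧ ψ) = (w , i ⊨ φ) × (w , i ⊨ ψ)

_⊨_ : Word → Formula → Set
w ⊨ φ = w , pos0 w ⊨ φ

W≤ω : Word → Set
W≤ω _ = ⊤

W=ω : Word → Set
W=ω (fin _ _) = ⊥
W=ω (inf _)   = ⊤

data Label : Set where
  pos neg : Label

Example : Set
Example = Word × Label

Fits : Formula → Example → Set
Fits φ (w Data.Product., pos) = w ⊨ φ
Fits φ (w Data.Product., neg) = ¬ (w ⊨ φ)

InClass : (Word → Set) → Example → Set
InClass C (w Data.Product., _) = C w

AdmitsFiniteCharacterizations : (Word → Set) → Set
AdmitsFiniteCharacterizations C =
  (φ : Formula) → ∃ λ (E : List Example) →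
    All (InClass C) E × All (Fits φ) E ×
    ((ψ : Formula) → All (Fits ψ) E →
       (w : Word) → C w → (w ⊨ ψ) ⇔ (w ⊨ φ))

-- Take φ₀ = F ((p ∧ q) ∧ F r) and ψₙ = F (p ∧ q) ∧ χₙ, where
-- χ₀ = F r and χₙ₊₁ = F (p ∧ F (q ∧ χₙ)).  A word satisfying φ₀
-- satisfies every ψₙ: all the p's and q's of χₙ can be read at the
-- position carrying p ∧ q.  Conversely, a word satisfying χₙ either
-- satisfies φ₀ or has an r at a position ≥ n, so a word violating φ₀
-- violates ψₙ once n is at least some position carrying p ∧ q.  Hence
-- every finite sample fitted by φ₀ is fitted by ψ_N for N large, while
-- the ω-word ({p}{q})ᴺ {r} {p,q} ∅^ω satisfies ψ_N but not φ₀.  Finding N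
-- requires deciding F (p ∧ q) on infinite words, so it only exists under
-- double negation, which is enough for a negative statement.
{-# OPTIONS --safe #-}
module Submission where

open import Defs
open import Data.Product using (_×_; ∃) renaming (_,_ to _&_)
open import Data.Nat using (ℕ; zero; suc; _+_; _≤_; _⊔_; z≤n; s≤s)
open import Data.Nat.Properties
  using ( ≤-refl; ≤-trans; n≤1+n; m≤m+n; m≤n+m; m≤n⇒m<n∨m≡n; +-monoʳ-<
        ; m⊔n≤o⇒m≤o; m⊔n≤o⇒n≤o; module ≤-Reasoning)
open import Data.Fin using (toℕ) renaming (zero to fzero; suc to fsuc)
open import Data.Fin.Properties using (toℕ-injective)
open import Data.Fin.Subset using (_∈_; ⁅_⁆; _∪_) renaming (⊥ to ∅)
open import Data.Vec using (here; there)
open import Data.List using (List; []; _∷_)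
open import Data.List.Relation.Unary.All as All using (All; []; _∷_)
open import Data.Sum using (_⊎_; inj₁; inj₂)
open import Data.Unit using (tt)
open import Data.Empty using (⊥)
open import Function using (id)
open import Function.Bundles using (Equivalence)
open import Level using (0ℓ)
open import Effect.Monad using (RawMonad)
open import Relation.Nullary using (¬_; Dec; yes; no)
open import Relation.Nullary.Negation using (DoubleNegation; ¬¬-Monad; ¬¬-map)
open import Relation.Nullary.Decidable using (¬¬-excluded-middle)
open import Relation.Binary.PropositionalEquality using (_≡_; subst)

open RawMonad (¬¬-Monad {0ℓ})

p q r : AP
p = fzero
q = fsuc fzero
r = fsuc (fsuc fzero)

index : (w : Word) → Pos w → ℕ
index (fin _ _) = toℕ
index (inf _)   = id

≤ₚ⇒≤ : (w : Word) {i j : Pos w} → _≤ₚ_ {w} i j → index w i ≤ index w j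
≤ₚ⇒≤ (fin _ _) = id
≤ₚ⇒≤ (inf _)   = id

≤⇒≤ₚ : (w : Word) {i j : Pos w} → index w i ≤ index w j → _≤ₚ_ {w} i j
≤⇒≤ₚ (fin _ _) = id
≤⇒≤ₚ (inf _)   = id

index-injective : (w : Word) {i j : Pos w} → index w i ≡ index w j → i ≡ j
index-injective (fin _ _) = toℕ-injective
index-injective (inf _)   = id

F-downward : (w : Word) {i j : Pos w} (θ : Formula) →
             index w i ≤ index w j → w , j ⊨ F θ → w , i ⊨ F θ
F-downward w θ i≤j (k & j≤k & θk) = k & ≤⇒≤ₚ w (≤-trans i≤j (≤ₚ⇒≤ w j≤k)) & θk

φ₀ : Formula
φ₀ = F ((atom p ∧ atom q) ∧ F (atom r))

χ : ℕ → Formula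
χ zero    = F (atom r)
χ (suc n) = F (atom p ∧ F (atom q ∧ χ n))

ψ : ℕ → Formula
ψ n = F (atom p ∧ atom q) ∧ χ n

φ₀-intro : (w : Word) {i j k : Pos w} → index w i ≤ index w j → index w j ≤ index w k →
           w , j ⊨ (atom p ∧ atom q) → w , k ⊨ atom r → w , i ⊨ φ₀
φ₀-intro w {j = j} {k} i≤j j≤k pqj rk = j & ≤⇒≤ₚ w i≤j & pqj & k & ≤⇒≤ₚ w j≤k & rk

χ-downward : (w : Word) {i j : Pos w} (n : ℕ) →
             index w i ≤ index w j → w , j ⊨ χ n → w , i ⊨ χ n
χ-downward w zero    = F-downward w (atom r)
χ-downward w (suc n) = F-downward w (atom p ∧ F (atom q ∧ χ n))

p∧q∧Fr⇒χ : (w : Word) {j : Pos w} → w , j ⊨ (atom p ∧ atom q) → w , j ⊨ F (atom r) →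
           (n : ℕ) → w , j ⊨ χ n
p∧q∧Fr⇒χ w pqj Frj zero    = Frj
p∧q∧Fr⇒χ w {j} (pj & qj) Frj (suc n) =
  j & j≤j & pj & j & j≤j & qj & p∧q∧Fr⇒χ w (pj & qj) Frj n
  where
  j≤j : _≤ₚ_ {w} j j
  j≤j = ≤⇒≤ₚ w ≤-refl

φ₀⇒ψ : (w : Word) → w ⊨ φ₀ → (n : ℕ) → w ⊨ ψ n
φ₀⇒ψ w (j & 0≤j & pqj & Frj) n =
  (j & 0≤j & pqj) & χ-downward w n (≤ₚ⇒≤ w 0≤j) (p∧q∧Fr⇒χ w pqj Frj n)

χ⇒φ₀⊎late-r : (w : Word) (i : Pos w) (n : ℕ) → w , i ⊨ χ n →
              w , i ⊨ φ₀ ⊎ ∃ λ k → w , k ⊨ atom r × n + index w i ≤ index w k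
χ⇒φ₀⊎late-r w i zero (k & i≤k & rk) = inj₂ (k & rk & ≤ₚ⇒≤ w i≤k)
χ⇒φ₀⊎late-r w i (suc n) (j & i≤j & pj & j′ & j≤j′ & qj′ & χj′)
  with χ⇒φ₀⊎late-r w j′ n χj′
     | m≤n⇒m<n∨m≡n (≤ₚ⇒≤ w j≤j′)
     | ≤-trans (≤ₚ⇒≤ w i≤j) (≤ₚ⇒≤ w j≤j′)
... | inj₁ φ₀j′ | _ | i≤j′ = inj₁ (F-downward w ((atom p ∧ atom q) ∧ F (atom r)) i≤j′ φ₀j′)
... | inj₂ (k & rk & n+j′≤k) | inj₁ j<j′ | _ = inj₂ (k & rk & n+i<k)
  where
  open ≤-Reasoning
  n+i<k : suc n + index w i ≤ index w k
  n+i<k = begin-strict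
    n + index w i  <⟨ +-monoʳ-< n (≤-trans (s≤s (≤ₚ⇒≤ w i≤j)) j<j′) ⟩
    n + index w j′ ≤⟨ n+j′≤k ⟩
    index w k      ∎
... | inj₂ (k & rk & n+j′≤k) | inj₂ j≡j′ | i≤j′ =
  inj₁ (φ₀-intro w i≤j′ (≤-trans (m≤n+m _ n) n+j′≤k)
          (subst (λ m → w , m ⊨ atom p) (index-injective w j≡j′) pj & qj′) rk)

F[p∧q]∧χ⇒φ₀ : (w : Word) {j : Pos w} → _≤ₚ_ {w} (pos0 w) j → w , j ⊨ (atom p ∧ atom q) →
              (n : ℕ) → index w j ≤ n → w ⊨ χ n → w ⊨ φ₀
F[p∧q]∧χ⇒φ₀ w 0≤j pqj n j≤n χn with χ⇒φ₀⊎late-r w (pos0 w) n χn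
... | inj₁ φ₀w               = φ₀w
... | inj₂ (k & rk & n+0≤k) =
  φ₀-intro w (≤ₚ⇒≤ w 0≤j) (≤-trans j≤n (≤-trans (m≤m+n n _) n+0≤k)) pqj rk

Eventually : (ℕ → Set) → Set
Eventually P = ∃ λ N → (n : ℕ) → N ≤ n → P n

¬φ₀⇒eventually-¬ψ : (w : Word) → ¬ (w ⊨ φ₀) → DoubleNegation (Eventually λ n → ¬ (w ⊨ ψ n))
¬φ₀⇒eventually-¬ψ w ¬φ₀ = ¬¬-map eventually-¬ψ ¬¬-excluded-middle
  where
  eventually-¬ψ : Dec (w ⊨ F (atom p ∧ atom q)) → Eventually λ n → ¬ (w ⊨ ψ n)
  eventually-¬ψ (yes (j & 0≤j & pqj)) =
    index w j & λ n j≤n (_ & χn) → ¬φ₀ (F[p∧q]∧χ⇒φ₀ w 0≤j pqj n j≤n χn)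
  eventually-¬ψ (no ¬F[p∧q])         = 0 & λ _ _ (F[p∧q] & _) → ¬F[p∧q] F[p∧q]

φ₀-fit⇒eventually-ψ-fit : (e : Example) → Fits φ₀ e →
                          DoubleNegation (Eventually λ n → Fits (ψ n) e)
φ₀-fit⇒eventually-ψ-fit (w & pos) w⊨φ₀  = pure (0 & λ n _ → φ₀⇒ψ w w⊨φ₀ n)
φ₀-fit⇒eventually-ψ-fit (w & neg) w⊭φ₀ = ¬φ₀⇒eventually-¬ψ w w⊭φ₀

¬¬-eventually-All : {A : Set} {P : A → ℕ → Set} {xs : List A} →
                    All (λ x → DoubleNegation (Eventually (P x))) xs →
                    DoubleNegation (Eventually λ n → All (λ x → P x n) xs)
¬¬-eventually-All []           = pure (0 & λ _ _ → [])
¬¬-eventually-All (evx ∷ evxs) = do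
  M & Px  ← evx
  N & Pxs ← ¬¬-eventually-All evxs
  pure (M ⊔ N & λ n M⊔N≤n → Px n (m⊔n≤o⇒m≤o M N M⊔N≤n) ∷ Pxs n (m⊔n≤o⇒n≤o M N M⊔N≤n))

infixr 5 _◃_
_◃_ : Letter → (ℕ → Letter) → ℕ → Letter
(a ◃ g) zero    = a
(a ◃ g) (suc i) = g i

◃-⊨ : (a : Letter) (g : ℕ → Letter) (θ : Formula) {i : ℕ} →
      inf g , i ⊨ θ → inf (a ◃ g) , suc i ⊨ θ
◃-⊨ a g (atom s)  si              = si
◃-⊨ a g (F θ)     (j & i≤j & θj) = suc j & s≤s i≤j & ◃-⊨ a g θ θj
◃-⊨ a g (θ ∧ θ′)  (θi & θ′i)     = ◃-⊨ a g θ θi & ◃-⊨ a g θ′ θ′i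

u : ℕ → ℕ → Letter
u zero    = ⁅ r ⁆ ◃ ⁅ p ⁆ ∪ ⁅ q ⁆ ◃ λ _ → ∅
u (suc n) = ⁅ p ⁆ ◃ ⁅ q ⁆ ◃ u n

u-suc-⊨ : (n : ℕ) (θ : Formula) {i : ℕ} →
          inf (u n) , i ⊨ θ → inf (u (suc n)) , suc (suc i) ⊨ θ
u-suc-⊨ n θ θi = ◃-⊨ ⁅ p ⁆ (⁅ q ⁆ ◃ u n) θ (◃-⊨ ⁅ q ⁆ (u n) θ θi)

u⊨F[p∧q] : (n : ℕ) → inf (u n) ⊨ F (atom p ∧ atom q)
u⊨F[p∧q] zero    = 1 & z≤n & here & there here
u⊨F[p∧q] (suc n) = F-downward (inf (u (suc n))) (atom p ∧ atom q) z≤n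
                     (u-suc-⊨ n (F (atom p ∧ atom q)) (u⊨F[p∧q] n))

u⊨χ : (n : ℕ) → inf (u n) ⊨ χ n
u⊨χ zero    = 0 & z≤n & there (there here)
u⊨χ (suc n) = 0 & z≤n & here & 1 & z≤n & there here
                & χ-downward (inf (u (suc n))) n (n≤1+n 1) (u-suc-⊨ n (χ n) (u⊨χ n))

u-no-r-after-p∧q : (n : ℕ) {j k : ℕ} → p ∈ u n j → q ∈ u n j → j ≤ k → r ∈ u n k → ⊥
u-no-r-after-p∧q zero    {0}                       ()
u-no-r-after-p∧q zero    {1}       {1}             _  _  _ (there (there ()))
u-no-r-after-p∧q zero    {1}       {suc (suc k)}   _  _  _ (there (there ()))
u-no-r-after-p∧q zero    {suc (suc j)}             ()
u-no-r-after-p∧q (suc n) {0}                       _  (there ())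
u-no-r-after-p∧q (suc n) {1}                       ()
u-no-r-after-p∧q (suc n) {suc (suc j)} {suc (suc k)} pj qj (s≤s (s≤s j≤k)) rk =
  u-no-r-after-p∧q n pj qj j≤k rk

u⊭φ₀ : (n : ℕ) → ¬ (inf (u n) ⊨ φ₀)
u⊭φ₀ n (j & _ & (pj & qj) & k & j≤k & rk) = u-no-r-after-p∧q n pj qj j≤k rk

¬AdmitsFiniteCharacterizations : (C : Word → Set) → ((n : ℕ) → C (inf (u n))) →
                                 ¬ AdmitsFiniteCharacterizations C
¬AdmitsFiniteCharacterizations C u∈C admits
  with E & _ & E-fits-φ₀ & E-characterizes-φ₀ ← admits φ₀ =
  ¬¬-eventually-All (All.map (λ {e} → φ₀-fit⇒eventually-ψ-fit e) E-fits-φ₀)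
    λ (N & E-fits-ψ) → u⊭φ₀ N (Equivalence.to
      (E-characterizes-φ₀ (ψ N) (E-fits-ψ N ≤-refl) (inf (u N)) (u∈C N))
      (u⊨F[p∧q] N & u⊨χ N))

theorem15 : ¬ AdmitsFiniteCharacterizations W≤ω × ¬ AdmitsFiniteCharacterizations W=ω
theorem15 = ¬AdmitsFiniteCharacterizations W≤ω (λ _ → tt)
          & ¬AdmitsFiniteCharacterizations W=ω (λ _ → tt)
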